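{- For every base $\mathscr B$, finite multisets of atoms $P,S$ and atom $q$: $P,S\vdash_{\mathscr B}q$ if and only if $P\Vdash^{S}_{\mathscr B}q$ (where the multiset of atoms $P$ is regarded as a multiset of atomic formulas).
   Context: Fix a countably infinite set $\mathbb{A}$ of atoms. $P,S,T,U,V$ denote finite multisets of atoms, "$P,S$" multiset union. An atomic rule is $(P_1\triangleright p_1,\dots,P_n\triangleright p_n)\Rightarrow p$ ($n\ge0$, $P_i$ finite multisets of atoms, $p_i,p$ atoms). A base is a (possibly infinite) set of atomic rules; $\mathscr X\supseteq\mathscr B$ means extension. Derivability $P\vdash_{\mathscr B}q$ is the least relation with: $[p]\vdash_{\mathscr B}p$ for every atom $p$; if $(P_1\triangleright p_1,\dots,P_n\triangleright p_n)\Rightarrow p\in\mathscr B$ and $S_i,P_i\vdash_{\mathscr B}p_i$ for $i=1,\dots,n$, then $S_1,\dots,S_n\vdash_{\mathscr B}p$. Support restricted to atoms: $\Vdash^{U}_{\mathscr B}p$ iff $U\vdash_{\mathscr B}p$; for a nonempty multiset of atoms $[p_1,\dots,p_n]$, $\Vdash^{U}_{\mathscr B}[p_1,\dots,p_n]$ iff $U=U_1,\dots,U_n$ for some $U_i$ with $\Vdash^{U_i}_{\mathscr B}p_i$ for each $i$; for nonempty $P$, $P\Vdash^S_{\mathscr B}q$ iff for every $\mathscr X\supseteq\mathscr B$ and every $U$, if $\Vdash^U_{\mathscr X}P$ then $\Vdash^{S,U}_{\mathscr X}q$; for empty $P$, $P\Vdash^S_{\mathscr B}q$ means $\Vdash^S_{\mathscr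 B}q$. -}

module Defs where

open import Level using (Level; suc; zero)
open import Data.Nat using (ℕ)
open import Data.List using (List; []; _∷_; _++_; concat)
open import Data.Product using (_×_; _,_; Σ; ∃)
open import Data.List.Relation.Binary.Permutation.Propositional using (_↭_)
open import Data.List.Relation.Binary.Pointwise using (Pointwise)

Atom : Set
Atom = ℕ

-- Finite multisets of atoms: lists, considered up to permutation (_↭_).
-- Multiset union "P , S" is list append _++_.
MSet : Set
MSet = List Atom

record Rule : Set where
  constructor _⇒_
  field
    premises   : List (MSet × Atom)
    conclusion : Atom
open Rule public

Base : Set₁
Base = Rule → Set

_⊇_ : Base → Base → Set
𝒳 ⊇ ℬ = ∀ r → ℬ r → 𝒳 r

data Der (ℬ : Base) : MSet → Atom → Set where
  ref : ∀ {U p} → U ↭ (p ∷ []) → Der ℬ U p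
  app : ∀ {U} (r : Rule) → ℬ r →
        (Ss : List MSet) →
        Pointwise (λ S Pp → Der ℬ (S ++ Data.Product.proj₁ Pp) (Data.Product.proj₂ Pp)) Ss (premises r) →
        U ↭ concat Ss →
        Der ℬ U (conclusion r)

_⊢[_]_ : MSet → Base → Atom → Set
U ⊢[ ℬ ] q = Der ℬ U q

⊩at : Base → MSet → Atom → Set
⊩at ℬ U p = U ⊢[ ℬ ] p

⊩ms : Base → MSet → MSet → Set
⊩ms ℬ U P = Σ (List MSet) λ Us → (U ↭ concat Us) × Pointwise (⊩at ℬ) Us P

_⊩[_][_]_ : MSet → MSet → Base → Atom → Set₁
[] ⊩[ S ][ ℬ ] q = Level.Lift (suc zero) (⊩at ℬ S q)
(p ∷ P) ⊩[ S ][ ℬ ] q =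
  ∀ (𝒳 : Base) → 𝒳 ⊇ ℬ → ∀ (U : MSet) → ⊩ms 𝒳 U (p ∷ P) → ⊩at 𝒳 (S ++ U) q

{-# OPTIONS --safe #-}
module Submission where

-- The forward direction is admissibility of cut: a derivation of P , S ⊢ q
-- stays valid in every extension 𝒳 ⊇ ℬ, and cutting it against derivations
-- Uᵢ ⊢ pᵢ of the atoms of P yields S , U ⊢ q.  Conversely, taking 𝒳 = ℬ and
-- U = P in the definition of support gives back P , S ⊢ q, since every atom
-- derives itself.

open import Defs
open import Data.List using (List; []; _∷_; _++_; concat; [_])
open import Data.List.Properties using (++-identityʳ; ++-assoc)
open import Data.List.Membership.Propositional using (_∈_)
open import Data.List.Membership.Propositional.Properties using (∈-∃++; ∈-++⁻)
open import Data.List.Relation.Unary.Any using (here)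
open import Data.List.Relation.Binary.Pointwise using (Pointwise; []; _∷_)
open import Data.List.Relation.Binary.Permutation.Propositional
open import Data.List.Relation.Binary.Permutation.Propositional.Properties
  using (↭-singleton-inv; ¬x∷xs↭[]; ∈-resp-↭; ++⁺ˡ; ++⁺ʳ; shift; shifts; drop-∷; ++-comm)
open import Data.Product using (∃; _×_; _,_; proj₁; proj₂)
open import Data.Sum using (inj₁; inj₂)
open import Data.Empty using (⊥-elim)
open import Function.Bundles using (_⇔_; mk⇔)
open import Level using (lift; lower)
open import Relation.Binary.PropositionalEquality using (refl; sym)

Premises : Base → List MSet → List (MSet × Atom) → Set
Premises ℬ = Pointwise (λ S Pp → Der ℬ (S ++ proj₁ Pp) (proj₂ Pp))

Der-resp-↭ : ∀ {ℬ U V q} → U ↭ V → Der ℬ U q → Der ℬ V q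
Der-resp-↭ U↭V (ref U↭q)               = ref (↭-trans (↭-sym U↭V) U↭q)
Der-resp-↭ U↭V (app r r∈ℬ Ss ds U↭Ss) = app r r∈ℬ Ss ds (↭-trans (↭-sym U↭V) U↭Ss)

mutual
  Der-mono : ∀ {ℬ 𝒳 U q} → 𝒳 ⊇ ℬ → Der ℬ U q → Der 𝒳 U q
  Der-mono 𝒳⊇ℬ (ref U↭q)               = ref U↭q
  Der-mono 𝒳⊇ℬ (app r r∈ℬ Ss ds U↭Ss) = app r (𝒳⊇ℬ r r∈ℬ) Ss (Premises-mono 𝒳⊇ℬ ds) U↭Ss

  Premises-mono : ∀ {ℬ 𝒳 Ss prems} → 𝒳 ⊇ ℬ → Premises ℬ Ss prems → Premises 𝒳 Ss prems
  Premises-mono 𝒳⊇ℬ []       = []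
  Premises-mono 𝒳⊇ℬ (d ∷ ds) = Der-mono 𝒳⊇ℬ d ∷ Premises-mono 𝒳⊇ℬ ds

∈⇒↭∷ : ∀ {p : Atom} {xs} → p ∈ xs → ∃ λ rest → xs ↭ p ∷ rest
∈⇒↭∷ {p} p∈xs with ys , zs , refl ← ∈-∃++ p∈xs = ys ++ zs , shift p ys zs

-- The context is only given up to permutation so that the recursive call on a
-- premise S ++ P, whose context contains p somewhere in S, is structural.
mutual
  Der-cut : ∀ {ℬ U Γ Δ p q} → Der ℬ U q → U ↭ p ∷ Γ → Der ℬ Δ p → Der ℬ (Δ ++ Γ) q
  Der-cut {Δ = Δ} (ref U↭q) U↭pΓ dp with ↭-singleton-inv (↭-trans (↭-sym U↭pΓ) U↭q)
  ... | refl = Der-resp-↭ (↭-reflexive (sym (++-identityʳ Δ))) dp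
  Der-cut (app r r∈ℬ Ss ds U↭Ss) U↭pΓ dp
    with Ss′ , ds′ , ΔΓ↭Ss′ ← Premises-cut ds (↭-trans (↭-sym U↭pΓ) U↭Ss) dp
    = app r r∈ℬ Ss′ ds′ ΔΓ↭Ss′

  Premises-cut : ∀ {ℬ Ss prems Γ Δ p} → Premises ℬ Ss prems → p ∷ Γ ↭ concat Ss → Der ℬ Δ p →
    ∃ λ Ss′ → Premises ℬ Ss′ prems × (Δ ++ Γ ↭ concat Ss′)
  Premises-cut [] pΓ↭[] dp = ⊥-elim (¬x∷xs↭[] pΓ↭[])
  Premises-cut {Ss = S ∷ Ss} {Γ = Γ} {Δ} {p} (_∷_ {y = P , _} dS ds) pΓ↭SSs dp
    with ∈-++⁻ S (∈-resp-↭ pΓ↭SSs (here refl))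
  ... | inj₁ p∈S with S′ , S↭pS′ ← ∈⇒↭∷ p∈S =
    (Δ ++ S′) ∷ Ss ,
    Der-resp-↭ (↭-reflexive (sym (++-assoc Δ S′ P))) (Der-cut dS (++⁺ʳ P S↭pS′) dp) ∷ ds ,
    ↭-trans (++⁺ˡ Δ Γ↭S′Ss) (↭-reflexive (sym (++-assoc Δ S′ (concat Ss))))
    where
    Γ↭S′Ss : Γ ↭ S′ ++ concat Ss
    Γ↭S′Ss = drop-∷ (↭-trans pΓ↭SSs (++⁺ʳ (concat Ss) S↭pS′))
  ... | inj₂ p∈Ss with R , Ss↭pR ← ∈⇒↭∷ p∈Ss
    with Ss′ , ds′ , ΔR↭Ss′ ← Premises-cut ds (↭-sym Ss↭pR) dp =
    S ∷ Ss′ , dS ∷ ds′ , ΔΓ↭SSs′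
    where
    open PermutationReasoning
    Γ↭SR : Γ ↭ S ++ R
    Γ↭SR = drop-∷ (↭-trans pΓ↭SSs (↭-trans (++⁺ˡ S Ss↭pR) (shift p S R)))
    ΔΓ↭SSs′ : Δ ++ Γ ↭ S ++ concat Ss′
    ΔΓ↭SSs′ = begin
      Δ ++ Γ         ↭⟨ ++⁺ˡ Δ Γ↭SR ⟩
      Δ ++ S ++ R    ↭⟨ shifts Δ S ⟩
      S ++ Δ ++ R    ↭⟨ ++⁺ˡ S ΔR↭Ss′ ⟩
      S ++ concat Ss′ ∎

Der-multicut : ∀ {ℬ q} P S (Us : List MSet) →
  Pointwise (Der ℬ) Us P → Der ℬ (P ++ S) q → Der ℬ (concat Us ++ S) q
Der-multicut [] S [] [] d = d
Der-multicut (p ∷ P) S (U ∷ Us) (dp ∷ dP) d =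
  Der-resp-↭ UsUS↭UUsS
    (Der-multicut P (U ++ S) Us dP (Der-resp-↭ (shifts U P) (Der-cut d ↭-refl dp)))
  where
  open PermutationReasoning
  UsUS↭UUsS : concat Us ++ U ++ S ↭ (U ++ concat Us) ++ S
  UsUS↭UUsS = begin
    concat Us ++ U ++ S   ≡⟨ sym (++-assoc (concat Us) U S) ⟩
    (concat Us ++ U) ++ S ↭⟨ ++⁺ʳ S (++-comm (concat Us) U) ⟩
    (U ++ concat Us) ++ S ∎

⊩ms-cut : ∀ {ℬ P S U q} → ⊩ms ℬ U P → Der ℬ (P ++ S) q → Der ℬ (S ++ U) q
⊩ms-cut {P = P} {S} {U} (Us , U↭Us , dP) d =
  Der-resp-↭ (↭-trans (++⁺ʳ S (↭-sym U↭Us)) (++-comm U S)) (Der-multicut P S Us dP d)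

⊩ms-refl : ∀ {ℬ} P → ⊩ms ℬ P P
⊩ms-refl []      = [] , ↭-refl , []
⊩ms-refl (p ∷ P) with Us , P↭Us , dP ← ⊩ms-refl P = [ p ] ∷ Us , ↭-prep p P↭Us , ref ↭-refl ∷ dP

proposition4 : ∀ (ℬ : Base) (P S : MSet) (q : Atom) → ((P ++ S) ⊢[ ℬ ] q) ⇔ (P ⊩[ S ][ ℬ ] q)
proposition4 ℬ [] S q = mk⇔ lift lower
proposition4 ℬ P@(_ ∷ _) S q = mk⇔ sound complete
  where
  sound : (P ++ S) ⊢[ ℬ ] q → P ⊩[ S ][ ℬ ] q
  sound d 𝒳 𝒳⊇ℬ U ⊩U = ⊩ms-cut ⊩U (Der-mono 𝒳⊇ℬ d)

  complete : P ⊩[ S ][ ℬ ] q → (P ++ S) ⊢[ ℬ ] q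
  complete P⊩q = Der-resp-↭ (++-comm S P) (P⊩q ℬ (λ _ r∈ℬ → r∈ℬ) P (⊩ms-refl P))
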